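{- There is no permutation $\pi$ (of any length $n$) such that $|q^{ -1}(\pi)|=3$, where $q^{ -1}(\pi)=\{\sigma\in S_n: q(\sigma)=\pi\}$.
   Context: $S_n$ is the set of permutations of $\{1,\dots,n\}$ in one-line notation $\pi=\pi_1\cdots\pi_n$. An entry $\pi_i$ is a left-to-right (LTR) maximum if $\pi_i>\pi_j$ for all $j<i$. The map $q:S_n\to S_n$ (the algorithm Queuesort, sorting with a queue allowing bypass) is described as follows: let $m_1,\dots,m_r$ be the LTR maxima of $\pi$ from left to right; for $i=r,r-1,\dots,1$ in this order, repeatedly swap $m_i$ with the entry immediately to its right as long as such an entry exists and is smaller than $m_i$; the result is $q(\pi)$ (e.g. $q(21543)=12435$). -}

module Defs where

open import Data.Nat using (ℕ; suc; _<ᵇ_; _≡ᵇ_)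
open import Data.Bool using (if_then_else_)
open import Data.List using (List; []; _∷_; map; upTo; foldr)
open import Data.List.Relation.Binary.Permutation.Propositional using (_↭_)

-- Permutations in S_n, one-line notation: lists that are a rearrangement of 1,…,n.
IsPerm : ℕ → List ℕ → Set
IsPerm n σ = σ ↭ map suc (upTo n)

-- left-to-right maxima (values), from left to right; entries are ≥ 1 so start with bound 0
ltrMaxAux : ℕ → List ℕ → List ℕ
ltrMaxAux acc [] = []
ltrMaxAux acc (x ∷ xs) = if acc <ᵇ x then x ∷ ltrMaxAux x xs else ltrMaxAux acc xs

ltrMaxima : List ℕ → List ℕ
ltrMaxima = ltrMaxAux 0

bubble : ℕ → List ℕ → List ℕ
bubble m [] = m ∷ []
bubble m (y ∷ ys) = if y <ᵇ m then y ∷ bubble m ys else m ∷ y ∷ ys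

moveRight : ℕ → List ℕ → List ℕ
moveRight v [] = []
moveRight v (x ∷ xs) = if x ≡ᵇ v then bubble x xs else x ∷ moveRight v xs

-- Queuesort: with LTR maxima m₁,…,m_r, process m_r, m_{r-1}, …, m₁ in this order
q : List ℕ → List ℕ
q π = foldr moveRight π (ltrMaxima π)

-- Let π = q σ with σ ∈ S_n. Queuesort carries n to the end, so π = ρ n. Call a left-to-right
-- maximum a of π that is not in first position and is immediately followed by a larger entry a
-- record ascent. If π has one, four preimages can be written down: n ρ, and permutations that put
-- a first and drop n into the block of smaller entries that precedes a in π (when that block is a
-- single entry x, the fourth is x a n followed by the rest). If π has none, tracing the first one
-- or two left-to-right maxima of a preimage through the algorithm shows that the preimage is ρ with
-- n inserted at position 0 or 1. So every fibre has at most two or at least four elements.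
module Submission where

open import Defs
open import Data.Nat using (ℕ; zero; suc; _<_; _≤_; _<ᵇ_; _≡ᵇ_; z≤n; s≤s; z<s)
open import Data.Nat.Properties
open import Data.Bool using (true; false)
open import Data.List using (List; []; _∷_; _++_; _∷ʳ_; [_]; length; map; upTo; foldr; take; drop)
open import Data.List.Properties using (++-assoc; ++-conicalʳ; ∷-injective; ∷-injectiveˡ; ∷-injectiveʳ; ∷ʳ-injectiveˡ)
open import Data.List.Membership.Propositional using (_∈_)
open import Data.List.Membership.Propositional.Properties using (∈-map⁻; ∈-map⁺; ∈-upTo⁺; ∈-upTo⁻; ∈-∃++; ∈-++⁺ʳ)
open import Data.List.Relation.Unary.Any as Any using (here; there)
open import Data.List.Relation.Unary.All as All using (All; []; _∷_)
open import Data.List.Relation.Unary.All.Properties using (++⁺; ++⁻ˡ; ++⁻ʳ)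
open import Data.List.Relation.Unary.Unique.Propositional using (Unique; []; _∷_)
open import Data.List.Relation.Unary.Unique.Propositional.Properties using (map⁺; upTo⁺)
open import Data.List.Relation.Binary.Subset.Propositional using (_⊆_)
open import Data.List.Relation.Binary.Permutation.Propositional using (_↭_; ↭-refl; ↭-sym; ↭-trans; ↭-prep; ↭-swap; ↭⇒↭ₛ)
open import Data.List.Relation.Binary.Permutation.Propositional.Properties using (All-resp-↭; ∈-resp-↭; ↭-empty-inv; ↭-length; shift)
open import Data.Product using (Σ; ∃; ∃₂; _×_; _,_; proj₁; uncurry)
open import Data.Sum as Sum using (_⊎_; inj₁; inj₂)
open import Function using (_∘_; id)
open import Function.Bundles using (_⇔_; Equivalence)
open import Relation.Binary.PropositionalEquality using (_≡_; _≢_; refl; sym; trans; cong; subst; setoid; module ≡-Reasoning)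
open import Relation.Nullary using (¬_; yes; no; contradiction)
open import Data.List.Relation.Binary.Permutation.Setoid.Properties (setoid ℕ) using (Unique-resp-↭)

Unique-adjacent : ∀ {A : Set} xs {a b : A} {ys} → Unique (xs ++ a ∷ b ∷ ys) → a ≢ b
Unique-adjacent [] ((a≢b ∷ _) ∷ _) = a≢b
Unique-adjacent (_ ∷ xs) (_ ∷ unique) = Unique-adjacent xs unique

Unique∧⊆⇒length≤ : ∀ {A : Set} {xs ys : List A} → Unique xs → xs ⊆ ys → length xs ≤ length ys
Unique∧⊆⇒length≤ {xs = []} _ _ = z≤n
Unique∧⊆⇒length≤ {xs = x ∷ xs} (x∉xs ∷ unique) xs⊆ys
  with as , bs , refl ← ∈-∃++ (xs⊆ys (here refl)) = begin
  suc (length xs)            ≤⟨ s≤s (Unique∧⊆⇒length≤ unique xs⊆as++bs) ⟩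
  suc (length (as ++ bs))    ≡⟨ ↭-length (shift x as bs) ⟨
  length (as ++ [ x ] ++ bs) ∎
  where
  open ≤-Reasoning
  xs⊆as++bs : xs ⊆ as ++ bs
  xs⊆as++bs y∈xs =
    Any.tail (λ y≡x → All.lookup x∉xs y∈xs (sym y≡x)) (∈-resp-↭ (shift x as bs) (xs⊆ys (there y∈xs)))

∷ʳ-split : ∀ {A : Set} xs {y v : A} {ys zs z} → xs ++ y ∷ v ∷ ys ≡ zs ∷ʳ z →
  ∃ λ T → zs ≡ xs ++ y ∷ T × v ∷ ys ≡ T ∷ʳ z
∷ʳ-split [] {zs = []} eq with () ← ∷-injectiveʳ eq
∷ʳ-split (_ ∷ xs) {zs = []} eq with () ← ++-conicalʳ xs _ (∷-injectiveʳ eq)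
∷ʳ-split [] {zs = _ ∷ zs} eq with refl , eq′ ← ∷-injective eq = zs , refl , eq′
∷ʳ-split (_ ∷ xs) {zs = _ ∷ zs} eq with refl , eq′ ← ∷-injective eq
  with T , refl , eq″ ← ∷ʳ-split xs eq′ = T , refl , eq″

<ᵇ-true : ∀ {m n} → m < n → (m <ᵇ n) ≡ true
<ᵇ-true {zero} z<s = refl
<ᵇ-true {suc m} (s≤s m<n) = <ᵇ-true m<n

<ᵇ-false : ∀ {m n} → n ≤ m → (m <ᵇ n) ≡ false
<ᵇ-false z≤n = refl
<ᵇ-false (s≤s n≤m) = <ᵇ-false n≤m

≡ᵇ-refl : ∀ n → (n ≡ᵇ n) ≡ true
≡ᵇ-refl zero = refl
≡ᵇ-refl (suc n) = ≡ᵇ-refl n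

≡ᵇ-false : ∀ {m n} → m < n → (m ≡ᵇ n) ≡ false
≡ᵇ-false {zero} z<s = refl
≡ᵇ-false {suc m} (s≤s m<n) = ≡ᵇ-false m<n

qFrom : ℕ → List ℕ → List ℕ
qFrom acc xs = foldr moveRight xs (ltrMaxAux acc xs)

ltrMaxAux-above : ∀ acc xs → All (acc <_) (ltrMaxAux acc xs)
ltrMaxAux-above acc [] = []
ltrMaxAux-above acc (x ∷ xs) with acc <? x
... | yes acc<x rewrite <ᵇ-true acc<x = acc<x ∷ All.map (<-trans acc<x) (ltrMaxAux-above x xs)
... | no acc≮x rewrite <ᵇ-false (≮⇒≥ acc≮x) = ltrMaxAux-above acc xs

foldr-moveRight-∷ : ∀ {x} xs vs → All (x <_) vs → foldr moveRight (x ∷ xs) vs ≡ x ∷ foldr moveRight xs vs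
foldr-moveRight-∷ xs [] [] = refl
foldr-moveRight-∷ xs (v ∷ vs) (x<v ∷ x<vs) rewrite foldr-moveRight-∷ xs vs x<vs | ≡ᵇ-false x<v = refl

qFrom-record : ∀ {acc x} xs → acc < x → qFrom acc (x ∷ xs) ≡ bubble x (qFrom x xs)
qFrom-record {x = x} xs acc<x
  rewrite <ᵇ-true acc<x | foldr-moveRight-∷ xs (ltrMaxAux x xs) (ltrMaxAux-above x xs) | ≡ᵇ-refl x = refl

qFrom-nonrecord : ∀ {acc x} xs → x ≤ acc → qFrom acc (x ∷ xs) ≡ x ∷ qFrom acc xs
qFrom-nonrecord {acc} xs x≤acc rewrite <ᵇ-false x≤acc =
  foldr-moveRight-∷ xs (ltrMaxAux acc xs) (All.map (≤-<-trans x≤acc) (ltrMaxAux-above acc xs))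

qFrom-bounded-prefix : ∀ {acc} xs ys → All (_≤ acc) xs → qFrom acc (xs ++ ys) ≡ xs ++ qFrom acc ys
qFrom-bounded-prefix [] ys [] = refl
qFrom-bounded-prefix (x ∷ xs) ys (x≤acc ∷ xs≤acc) =
  trans (qFrom-nonrecord (xs ++ ys) x≤acc) (cong (x ∷_) (qFrom-bounded-prefix xs ys xs≤acc))

qFrom-bounded : ∀ {acc} xs → All (_≤ acc) xs → qFrom acc xs ≡ xs
qFrom-bounded [] [] = refl
qFrom-bounded (x ∷ xs) (x≤acc ∷ xs≤acc) =
  trans (qFrom-nonrecord xs x≤acc) (cong (x ∷_) (qFrom-bounded xs xs≤acc))

bubble-↭ : ∀ m ys → bubble m ys ↭ m ∷ ys
bubble-↭ m [] = ↭-refl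
bubble-↭ m (y ∷ ys) with y <ᵇ m
... | true = ↭-trans (↭-prep y (bubble-↭ m ys)) (↭-swap y m ↭-refl)
... | false = ↭-refl

qFrom-↭ : ∀ acc xs → qFrom acc xs ↭ xs
qFrom-↭ acc [] = ↭-refl
qFrom-↭ acc (x ∷ xs) with acc <? x
... | yes acc<x rewrite qFrom-record xs acc<x = ↭-trans (bubble-↭ x (qFrom x xs)) (↭-prep x (qFrom-↭ x xs))
... | no acc≮x rewrite qFrom-nonrecord xs (≮⇒≥ acc≮x) = ↭-prep x (qFrom-↭ acc xs)

bubble-++ : ∀ {m} xs ys → All (_< m) xs → bubble m (xs ++ ys) ≡ xs ++ bubble m ys
bubble-++ [] ys [] = refl
bubble-++ (x ∷ xs) ys (x<m ∷ xs<m) rewrite <ᵇ-true x<m = cong (x ∷_) (bubble-++ xs ys xs<m)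

bubble-to-end : ∀ {m} ys → All (_< m) ys → bubble m ys ≡ ys ∷ʳ m
bubble-to-end [] [] = refl
bubble-to-end (y ∷ ys) (y<m ∷ ys<m) rewrite <ᵇ-true y<m = cong (y ∷_) (bubble-to-end ys ys<m)

bubble-blocked : ∀ {m y} ys → m < y → bubble m (y ∷ ys) ≡ m ∷ y ∷ ys
bubble-blocked ys m<y rewrite <ᵇ-false (<⇒≤ m<y) = refl

bubble-stops-below : ∀ {a n} R → n ∈ R → a < n →
  ∃₂ λ P b → ∃ λ S → R ≡ P ++ b ∷ S × bubble a R ≡ P ++ a ∷ b ∷ S × All (_< a) P × a ≤ b
bubble-stops-below {a} (y ∷ R) n∈R a<n with y <? a
... | no y≮a rewrite <ᵇ-false (≮⇒≥ y≮a) = [] , y , R , refl , refl , [] , ≮⇒≥ y≮a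
... | yes y<a rewrite <ᵇ-true y<a with n∈R
...   | here refl = contradiction (<-trans y<a a<n) (<-irrefl refl)
...   | there n∈R′ with P , b , S , R≡ , bubble≡ , P<a , a≤b ← bubble-stops-below R n∈R′ a<n
      = y ∷ P , b , S , cong (y ∷_) R≡ , cong (y ∷_) bubble≡ , y<a ∷ P<a , a≤b

bubble-∷ʳ-max : ∀ {m N} ρ → m < N → ∃ λ ρ′ → bubble m (ρ ∷ʳ N) ≡ ρ′ ∷ʳ N
bubble-∷ʳ-max [] m<N = [ _ ] , bubble-blocked [] m<N
bubble-∷ʳ-max {m} (y ∷ ρ) m<N with y <? m
... | no y≮m rewrite <ᵇ-false (≮⇒≥ y≮m) = m ∷ y ∷ ρ , refl
... | yes y<m rewrite <ᵇ-true y<m with ρ′ , e ← bubble-∷ʳ-max ρ m<N = y ∷ ρ′ , cong (y ∷_) e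

bubble-qFrom-below : ∀ {n} xs → All (_< n) xs → bubble n (qFrom n xs) ≡ xs ∷ʳ n
bubble-qFrom-below {n} xs xs<n =
  trans (cong (bubble n) (qFrom-bounded xs (All.map <⇒≤ xs<n))) (bubble-to-end xs xs<n)

qFrom-max-first : ∀ {acc n} xs → acc < n → All (_< n) xs → qFrom acc (n ∷ xs) ≡ xs ∷ʳ n
qFrom-max-first xs acc<n xs<n = trans (qFrom-record xs acc<n) (bubble-qFrom-below xs xs<n)

qFrom-ends-with-max : ∀ {acc N} xs ys → acc < N → All (_< N) xs → All (_< N) ys →
  ∃ λ ρ → qFrom acc (xs ++ N ∷ ys) ≡ ρ ∷ʳ N
qFrom-ends-with-max [] ys acc<N [] ys<N = ys , qFrom-max-first ys acc<N ys<N
qFrom-ends-with-max {acc} {N} (x ∷ xs) ys acc<N (x<N ∷ xs<N) ys<N with acc <? x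
... | yes acc<x =
  let ρ , e = qFrom-ends-with-max xs ys x<N xs<N ys<N
      ρ′ , e′ = bubble-∷ʳ-max ρ x<N
  in ρ′ , trans (qFrom-record (xs ++ N ∷ ys) acc<x) (trans (cong (bubble x) e) e′)
... | no acc≮x =
  let ρ , e = qFrom-ends-with-max xs ys acc<N xs<N ys<N
  in x ∷ ρ , trans (qFrom-nonrecord (xs ++ N ∷ ys) (≮⇒≥ acc≮x)) (cong (x ∷_) e)

qFrom-head-above : ∀ {acc b S} xs → qFrom acc xs ≡ b ∷ S → acc < b → ∃₂ λ y ys → xs ≡ y ∷ ys × acc < y
qFrom-head-above {acc} {b} (y ∷ ys) qxs≡ acc<b with acc <? y
... | yes acc<y = y , ys , refl , acc<y
... | no acc≮y = contradiction (subst (acc <_) (sym y≡b) acc<b) acc≮y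
  where
  y≡b : y ≡ b
  y≡b = ∷-injectiveˡ (trans (sym (qFrom-nonrecord ys (≮⇒≥ acc≮y))) qxs≡)

qFrom-record-before-max : ∀ {acc a n} P₁ P₂ T → acc < a → a < n →
  All (_< a) P₁ → All (_< a) P₂ → All (_< n) T → bubble a (T ∷ʳ n) ≡ a ∷ T ∷ʳ n →
  qFrom acc (a ∷ P₁ ++ n ∷ P₂ ++ T) ≡ P₁ ++ P₂ ++ a ∷ T ∷ʳ n
qFrom-record-before-max {acc} {a} {n} P₁ P₂ T acc<a a<n P₁<a P₂<a T<n a-stays = begin
  qFrom acc (a ∷ P₁ ++ n ∷ P₂ ++ T)      ≡⟨ qFrom-record (P₁ ++ n ∷ P₂ ++ T) acc<a ⟩
  bubble a (qFrom a (P₁ ++ n ∷ P₂ ++ T)) ≡⟨ cong (bubble a) (qFrom-bounded-prefix P₁ _ (All.map <⇒≤ P₁<a)) ⟩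
  bubble a (P₁ ++ qFrom a (n ∷ P₂ ++ T)) ≡⟨ cong (λ r → bubble a (P₁ ++ r)) (qFrom-max-first (P₂ ++ T) a<n P₂T<n) ⟩
  bubble a (P₁ ++ (P₂ ++ T) ∷ʳ n)        ≡⟨ cong (λ r → bubble a (P₁ ++ r)) (++-assoc P₂ T [ n ]) ⟩
  bubble a (P₁ ++ P₂ ++ T ∷ʳ n)          ≡⟨ bubble-++ P₁ _ P₁<a ⟩
  P₁ ++ bubble a (P₂ ++ T ∷ʳ n)          ≡⟨ cong (P₁ ++_) (bubble-++ P₂ _ P₂<a) ⟩
  P₁ ++ P₂ ++ bubble a (T ∷ʳ n)          ≡⟨ cong (λ r → P₁ ++ P₂ ++ r) a-stays ⟩
  P₁ ++ P₂ ++ a ∷ T ∷ʳ n                 ∎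
  where
  open ≡-Reasoning
  P₂T<n : All (_< n) (P₂ ++ T)
  P₂T<n = ++⁺ (All.map (λ x<a → <-trans x<a a<n) P₂<a) T<n

∈-qFrom : ∀ acc xs {x} → x ∈ xs → x ∈ qFrom acc xs
∈-qFrom acc xs = ∈-resp-↭ (↭-sym (qFrom-↭ acc xs))

last-∈-preimage : ∀ {n ρ} σ → q σ ≡ ρ ∷ʳ n → n ∈ σ
last-∈-preimage {ρ = ρ} σ qσ≡ = ∈-resp-↭ (qFrom-↭ 0 σ) (subst (_ ∈_) (sym qσ≡) (∈-++⁺ʳ ρ (here refl)))

perm-unique : ∀ {n σ} → IsPerm n σ → Unique σ
perm-unique {n} σ↭ = Unique-resp-↭ (↭⇒↭ₛ (↭-sym σ↭)) (map⁺ suc-injective (upTo⁺ n))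

perm-bounded : ∀ {n σ} → IsPerm n σ → All (λ x → 0 < x × x ≤ n) σ
perm-bounded {n} σ↭ = All-resp-↭ (↭-sym σ↭) (All.tabulate bounds)
  where
  bounds : ∀ {x} → x ∈ map suc (upTo n) → 0 < x × x ≤ n
  bounds x∈ with _ , i∈ , refl ← ∈-map⁻ suc x∈ = z<s , ∈-upTo⁻ i∈

perm-∋-max : ∀ {k σ} → IsPerm (suc k) σ → suc k ∈ σ
perm-∋-max {k} σ↭ = ∈-resp-↭ (↭-sym σ↭) (∈-map⁺ suc (∈-upTo⁺ (n<1+n k)))

perm-max-first : ∀ {n xs} → IsPerm n (n ∷ xs) → All (_< n) xs
perm-max-first σ↭ with n∉xs ∷ _ ← perm-unique σ↭ | _ ∷ bounds ← perm-bounded σ↭ =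
  All.zipWith (λ ((_ , x≤n) , n≢x) → ≤∧≢⇒< x≤n (n≢x ∘ sym)) (bounds , n∉xs)

perm-others-below : ∀ {n} xs {ys} → IsPerm n (xs ++ n ∷ ys) → All (_< n) (xs ++ ys)
perm-others-below {n} xs {ys} σ↭ = perm-max-first (↭-trans (↭-sym (shift n xs ys)) σ↭)

q-perm : ∀ {n σ} → IsPerm n σ → IsPerm n (q σ)
q-perm {σ = σ} σ↭ = ↭-trans (qFrom-↭ 0 σ) σ↭

preimage-perm : ∀ {n σ τ} → IsPerm n σ → q τ ≡ q σ → IsPerm n τ
preimage-perm {n} {τ = τ} σ↭ qτ≡ = ↭-trans (↭-sym (qFrom-↭ 0 τ)) (subst (IsPerm n) (sym qτ≡) (q-perm σ↭))

q-ends-with-max : ∀ {k σ} → IsPerm (suc k) σ → ∃ λ ρ → q σ ≡ ρ ∷ʳ suc k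
q-ends-with-max σ↭ with xs , ys , refl ← ∈-∃++ (perm-∋-max σ↭) =
  let others<n = perm-others-below xs σ↭
  in qFrom-ends-with-max xs ys z<s (++⁻ˡ xs others<n) (++⁻ʳ xs others<n)

data RecordAscent (π : List ℕ) : Set where
  record-ascent : ∀ p P a b S → π ≡ (p ∷ P) ++ a ∷ b ∷ S → All (_< a) (p ∷ P) → a < b → RecordAscent π

record-ascent-unless-first : ∀ {π a b} pre P S → π ≡ (pre ++ P) ++ a ∷ b ∷ S →
  All (_< a) pre → All (_< a) P → a < b → RecordAscent π ⊎ (pre ≡ [] × P ≡ [])
record-ascent-unless-first (p ∷ pre) P S π≡ (p<a ∷ pre<a) P<a a<b =
  inj₁ (record-ascent p (pre ++ P) _ _ S π≡ (p<a ∷ ++⁺ pre<a P<a) a<b)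
record-ascent-unless-first [] (p ∷ P) S π≡ [] P<a a<b = inj₁ (record-ascent p P _ _ S π≡ P<a a<b)
record-ascent-unless-first [] [] _ _ _ _ _ = inj₂ (refl , refl)

bubble-record-ascent : ∀ {a n} pre R → All (_< a) pre → a < n → n ∈ R → Unique (pre ++ bubble a R) →
  RecordAscent (pre ++ bubble a R) ⊎ (pre ≡ [] × ∃₂ λ b S → R ≡ b ∷ S × a < b)
bubble-record-ascent {a} pre R pre<a a<n n∈R unique
  with P , b , S , R≡ , bubble≡ , P<a , a≤b ← bubble-stops-below R n∈R a<n =
  let π≡ = trans (cong (pre ++_) bubble≡) (sym (++-assoc pre P _))
      a<b = ≤∧≢⇒< a≤b (Unique-adjacent (pre ++ P) (subst Unique π≡ unique))
  in Sum.map₂ (λ { (refl , refl) → refl , b , S , R≡ , a<b })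
              (record-ascent-unless-first pre P S π≡ pre<a P<a a<b)

shape-after-second-record : ∀ {n m y τ ρ} → IsPerm n (m ∷ y ∷ τ) → m < y →
  q (m ∷ y ∷ τ) ≡ m ∷ bubble y (qFrom y τ) → q (m ∷ y ∷ τ) ≡ ρ ∷ʳ n →
  RecordAscent (q (m ∷ y ∷ τ)) ⊎ m ∷ y ∷ τ ≡ take 1 ρ ++ n ∷ drop 1 ρ
shape-after-second-record {n} {m} {y} {τ} {ρ} σ↭ m<y qσ≡ qσ≡ρn with y ≟ n
... | yes refl = inj₂ (cong (λ ρ → take 1 ρ ++ y ∷ drop 1 ρ) mτ≡ρ)
  where
  mτ≡ρ : m ∷ τ ≡ ρ
  mτ≡ρ = ∷ʳ-injectiveˡ (m ∷ τ) ρ (begin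
    m ∷ τ ∷ʳ y                ≡⟨ cong (m ∷_) (bubble-qFrom-below τ (All.tail (perm-others-below (m ∷ []) σ↭))) ⟨
    m ∷ bubble y (qFrom y τ)  ≡⟨ qσ≡ ⟨
    q (m ∷ y ∷ τ)             ≡⟨ qσ≡ρn ⟩
    ρ ∷ʳ y                    ∎)
    where open ≡-Reasoning
... | no y≢n with _ ∷ (_ , y≤n) ∷ _ ← perm-bounded σ↭ =
  let y<n = ≤∧≢⇒< y≤n y≢n
      n∈σ = last-∈-preimage (m ∷ y ∷ τ) qσ≡ρn
      n∈qτ = ∈-qFrom y τ (Any.tail (>⇒≢ y<n) (Any.tail (>⇒≢ (<-trans m<y y<n)) n∈σ))
      unique = subst Unique qσ≡ (perm-unique (q-perm σ↭))
  in Sum.[ inj₁ ∘ subst RecordAscent (sym qσ≡) , (λ { (() , _) }) ]′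
       (bubble-record-ascent (m ∷ []) (qFrom y τ) (m<y ∷ []) y<n n∈qτ unique)

shape-after-first-record : ∀ {n m τ ρ} → IsPerm n (m ∷ τ) → 0 < m → m < n → q (m ∷ τ) ≡ ρ ∷ʳ n →
  RecordAscent (q (m ∷ τ)) ⊎ m ∷ τ ≡ take 1 ρ ++ n ∷ drop 1 ρ
shape-after-first-record {n} {m} {τ} σ↭ 0<m m<n qσ≡ρn
  with bubble-record-ascent [] (qFrom m τ) [] m<n
         (∈-qFrom m τ (Any.tail (>⇒≢ m<n) (last-∈-preimage (m ∷ τ) qσ≡ρn)))
         (subst Unique (qFrom-record τ 0<m) (perm-unique (q-perm σ↭)))
... | inj₁ ascent = inj₁ (subst RecordAscent (sym (qFrom-record τ 0<m)) ascent)
... | inj₂ (_ , b , S , qτ≡ , m<b) with y , τ′ , refl , m<y ← qFrom-head-above τ qτ≡ m<b =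
  shape-after-second-record σ↭ m<y qσ≡ qσ≡ρn
  where
  open ≡-Reasoning
  qσ≡ : q (m ∷ y ∷ τ′) ≡ m ∷ bubble y (qFrom y τ′)
  qσ≡ = begin
    q (m ∷ y ∷ τ′)               ≡⟨ qFrom-record (y ∷ τ′) 0<m ⟩
    bubble m (qFrom m (y ∷ τ′))  ≡⟨ cong (bubble m) qτ≡ ⟩
    bubble m (b ∷ S)             ≡⟨ bubble-blocked S m<b ⟩
    m ∷ b ∷ S                    ≡⟨ cong (m ∷_) qτ≡ ⟨
    m ∷ qFrom m (y ∷ τ′)         ≡⟨ cong (m ∷_) (qFrom-record τ′ m<y) ⟩
    m ∷ bubble y (qFrom y τ′)    ∎

preimage-shape : ∀ {n σ ρ} → IsPerm n σ → q σ ≡ ρ ∷ʳ n →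
  RecordAscent (q σ) ⊎ σ ∈ (n ∷ ρ) ∷ (take 1 ρ ++ n ∷ drop 1 ρ) ∷ []
preimage-shape {σ = []} _ qσ≡ with () ← last-∈-preimage [] qσ≡
preimage-shape {n} {m ∷ τ} {ρ} σ↭ qσ≡ρn with perm-bounded σ↭ | m ≟ n
... | (0<m , _) ∷ _ | yes refl = inj₂ (here (cong (m ∷_) (∷ʳ-injectiveˡ τ ρ τm≡ρm)))
  where
  τm≡ρm : τ ∷ʳ m ≡ ρ ∷ʳ m
  τm≡ρm = trans (sym (qFrom-max-first τ 0<m (perm-max-first σ↭))) qσ≡ρn
... | (0<m , m≤n) ∷ _ | no m≢n =
  Sum.map₂ (there ∘ here) (shape-after-first-record σ↭ 0<m (≤∧≢⇒< m≤n m≢n) qσ≡ρn)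

DistinctPreimages : ℕ → List ℕ → Set
DistinctPreimages k π = Σ (List (List ℕ)) λ F → length F ≡ k × Unique F × All (λ σ → q σ ≡ π) F

four-preimages : ∀ {n p a} P T → 0 < p → All (_< a) (p ∷ P) → a < n → All (_< n) T →
  bubble a (T ∷ʳ n) ≡ a ∷ T ∷ʳ n → DistinctPreimages 4 ((p ∷ P) ++ a ∷ T ∷ʳ n)
four-preimages {n} {x} {a} [] T 0<x (x<a ∷ []) a<n T<n a-stays =
  _ , refl , distinct , qσ₁ ∷ qσ₂ ∷ qσ₃ ∷ qσ₄ ∷ []
  where
  0<a : 0 < a
  0<a = <-trans 0<x x<a
  x<n : x < n
  x<n = <-trans x<a a<n
  qσ₁ : q (n ∷ x ∷ a ∷ T) ≡ x ∷ a ∷ T ∷ʳ n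
  qσ₁ = qFrom-max-first (x ∷ a ∷ T) (<-trans 0<x x<n) (x<n ∷ a<n ∷ T<n)
  qσ₂ : q (a ∷ n ∷ x ∷ T) ≡ x ∷ a ∷ T ∷ʳ n
  qσ₂ = qFrom-record-before-max [] (x ∷ []) T 0<a a<n [] (x<a ∷ []) T<n a-stays
  qσ₃ : q (a ∷ x ∷ n ∷ T) ≡ x ∷ a ∷ T ∷ʳ n
  qσ₃ = qFrom-record-before-max (x ∷ []) [] T 0<a a<n (x<a ∷ []) [] T<n a-stays
  qσ₄ : q (x ∷ a ∷ n ∷ T) ≡ x ∷ a ∷ T ∷ʳ n
  qσ₄ = trans (qFrom-record (a ∷ n ∷ T) 0<x)
          (trans (cong (bubble x) (qFrom-record-before-max [] [] T x<a a<n [] [] T<n a-stays))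
                 (bubble-blocked (T ∷ʳ n) x<a))
  distinct : Unique ((n ∷ x ∷ a ∷ T) ∷ (a ∷ n ∷ x ∷ T) ∷ (a ∷ x ∷ n ∷ T) ∷ (x ∷ a ∷ n ∷ T) ∷ [])
  distinct =
    (>⇒≢ a<n ∘ ∷-injectiveˡ ∷ >⇒≢ a<n ∘ ∷-injectiveˡ ∷ >⇒≢ x<n ∘ ∷-injectiveˡ ∷ []) ∷
    (>⇒≢ x<n ∘ ∷-injectiveˡ ∘ ∷-injectiveʳ ∷ >⇒≢ x<a ∘ ∷-injectiveˡ ∷ []) ∷
    (>⇒≢ x<a ∘ ∷-injectiveˡ ∷ []) ∷ [] ∷ []
four-preimages {n} {x} {a} (y ∷ X) T 0<x (x<a ∷ y<a ∷ X<a) a<n T<n a-stays =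
  _ , refl , distinct , qσ₁ ∷ qσ₂ ∷ qσ₃ ∷ qσ₄ ∷ []
  where
  0<a : 0 < a
  0<a = <-trans 0<x x<a
  x<n : x < n
  x<n = <-trans x<a a<n
  ρ<n : All (_< n) (x ∷ y ∷ X ++ a ∷ T)
  ρ<n = ++⁺ (All.map (λ z<a → <-trans z<a a<n) (x<a ∷ y<a ∷ X<a)) (a<n ∷ T<n)
  qσ₁ : q (n ∷ x ∷ y ∷ X ++ a ∷ T) ≡ x ∷ y ∷ X ++ a ∷ T ∷ʳ n
  qσ₁ = trans (qFrom-max-first _ (<-trans 0<a a<n) ρ<n) (++-assoc (x ∷ y ∷ X) (a ∷ T) [ n ])
  qσ₂ : q (a ∷ n ∷ x ∷ y ∷ X ++ T) ≡ x ∷ y ∷ X ++ a ∷ T ∷ʳ n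
  qσ₂ = qFrom-record-before-max [] (x ∷ y ∷ X) T 0<a a<n [] (x<a ∷ y<a ∷ X<a) T<n a-stays
  qσ₃ : q (a ∷ x ∷ n ∷ y ∷ X ++ T) ≡ x ∷ y ∷ X ++ a ∷ T ∷ʳ n
  qσ₃ = qFrom-record-before-max (x ∷ []) (y ∷ X) T 0<a a<n (x<a ∷ []) (y<a ∷ X<a) T<n a-stays
  qσ₄ : q (a ∷ x ∷ y ∷ n ∷ X ++ T) ≡ x ∷ y ∷ X ++ a ∷ T ∷ʳ n
  qσ₄ = qFrom-record-before-max (x ∷ y ∷ []) X T 0<a a<n (x<a ∷ y<a ∷ []) X<a T<n a-stays
  distinct : Unique ((n ∷ x ∷ y ∷ X ++ a ∷ T) ∷ (a ∷ n ∷ x ∷ y ∷ X ++ T) ∷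
                     (a ∷ x ∷ n ∷ y ∷ X ++ T) ∷ (a ∷ x ∷ y ∷ n ∷ X ++ T) ∷ [])
  distinct =
    (>⇒≢ a<n ∘ ∷-injectiveˡ ∷ >⇒≢ a<n ∘ ∷-injectiveˡ ∷ >⇒≢ a<n ∘ ∷-injectiveˡ ∷ []) ∷
    (>⇒≢ x<n ∘ ∷-injectiveˡ ∘ ∷-injectiveʳ ∷ >⇒≢ x<n ∘ ∷-injectiveˡ ∘ ∷-injectiveʳ ∷ []) ∷
    (>⇒≢ (<-trans y<a a<n) ∘ ∷-injectiveˡ ∘ ∷-injectiveʳ ∘ ∷-injectiveʳ ∷ []) ∷ [] ∷ []

record-ascent⇒four-preimages : ∀ {n σ} → IsPerm n σ → RecordAscent (q σ) → DistinctPreimages 4 (q σ)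
record-ascent⇒four-preimages {zero} σ↭ (record-ascent _ _ _ _ _ qσ≡ _ _)
  with refl ← ↭-empty-inv σ↭ with () ← qσ≡
record-ascent⇒four-preimages {suc k} {σ} σ↭ (record-ascent p P a b S qσ≡ P<a a<b)
  with ρ , qσ≡ρn ← q-ends-with-max σ↭
  with T , refl , bS≡ ← ∷ʳ-split (p ∷ P) (trans (sym qσ≡) qσ≡ρn)
  with 0<p ∷ _ ← subst (All (0 <_)) qσ≡ (All.map proj₁ (perm-bounded (q-perm σ↭)))
  with a<n ∷ T<n ← ++⁻ʳ (p ∷ P) (++⁻ˡ ρ (perm-others-below ρ (subst (IsPerm (suc k)) qσ≡ρn (q-perm σ↭))))
  = subst (DistinctPreimages 4) (sym (trans qσ≡ρn (++-assoc (p ∷ P) (a ∷ T) [ suc k ])))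
      (four-preimages P T 0<p P<a a<n T<n (subst (λ R → bubble a R ≡ a ∷ R) bS≡ (bubble-blocked S a<b)))

preimages-without-ascent : ∀ {n σ} → IsPerm n σ → ¬ RecordAscent (q σ) →
  Σ (List (List ℕ)) λ C → length C ≤ 2 × (∀ {τ} → IsPerm n τ → q τ ≡ q σ → τ ∈ C)
preimages-without-ascent {zero} _ _ = [] ∷ [] , s≤s z≤n , λ τ↭ _ → here (↭-empty-inv τ↭)
preimages-without-ascent {suc k} σ↭ no-ascent with ρ , qσ≡ρn ← q-ends-with-max σ↭ =
  _ , ≤-refl , λ τ↭ qτ≡ →
    Sum.[ (λ ascent → contradiction (subst RecordAscent qτ≡ ascent) no-ascent) , id ]′
      (preimage-shape τ↭ (trans qτ≡ qσ≡ρn))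

fiber-length-≤2-or-≥4 : ∀ {n σ} (L : List (List ℕ)) → IsPerm n σ → Unique L →
  ((τ : List ℕ) → τ ∈ L ⇔ (IsPerm n τ × q τ ≡ q σ)) → length L ≤ 2 ⊎ 4 ≤ length L
fiber-length-≤2-or-≥4 {n} {σ} L σ↭ unique fiber with 4 ≤? length L
... | yes 4≤ = inj₂ 4≤
... | no 4≰ =
  let C , |C|≤2 , preimage∈C = preimages-without-ascent σ↭ (no-ascent 4≰)
      L⊆C : L ⊆ C
      L⊆C {τ} τ∈L = uncurry preimage∈C (Equivalence.to (fiber τ) τ∈L)
  in inj₁ (≤-trans (Unique∧⊆⇒length≤ unique L⊆C) |C|≤2)
  where
  no-ascent : ¬ 4 ≤ length L → ¬ RecordAscent (q σ)
  no-ascent 4≰ ascent =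
    let F , |F|≡4 , unique-F , qF≡ = record-ascent⇒four-preimages σ↭ ascent
        F⊆L : F ⊆ L
        F⊆L τ∈F = let qτ≡ = All.lookup qF≡ τ∈F
                  in Equivalence.from (fiber _) (preimage-perm σ↭ qτ≡ , qτ≡)
    in 4≰ (subst (_≤ length L) |F|≡4 (Unique∧⊆⇒length≤ unique-F F⊆L))

proposition4p11 : (n : ℕ) (π : List ℕ) →
    ¬ (Σ (List (List ℕ)) λ L →
         (length L ≡ 3) × Unique L ×
         ((σ : List ℕ) → (σ ∈ L) ⇔ (IsPerm n σ × q σ ≡ π)))
proposition4p11 n π ([] , () , _)
proposition4p11 n π (σ ∷ L , |L|≡3 , unique , fiber) with Equivalence.to (fiber σ) (here refl)
... | σ↭ , refl with fiber-length-≤2-or-≥4 (σ ∷ L) σ↭ unique fiber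
...   | inj₁ |L|≤2 = ≤⇒≯ (subst (_≤ 2) |L|≡3 |L|≤2) ≤-refl
...   | inj₂ 4≤|L| = ≤⇒≯ (subst (4 ≤_) |L|≡3 4≤|L|) ≤-refl
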